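{- Let $n$ be a nonnegative integer. Then \[ \binom{3n}{n}=\sum_{j=n}^{2n}(-1)^{n+j}\binom{2n}{j}\frac{2n+1}{j+1}+\sum_{j=0}^{n-1}\binom{n+j}{j}\binom{2n-j-1}{n-j}. \]
   Context: An empty sum equals $0$. -}

module Defs where

open import Data.Nat using (ℕ; zero; suc; _∸_)
open import Data.Rational using (ℚ; 0ℚ; _+_)

sumBelow : (ℕ → ℚ) → ℕ → ℚ
sumBelow f zero    = 0ℚ
sumBelow f (suc k) = sumBelow f k + f k

-- Σ_{a ≤ j < b} f j  (half-open range; empty when b ≤ a)
sumFromTo : ℕ → ℕ → (ℕ → ℚ) → ℚ
sumFromTo a b f = sumBelow (λ i → f (a Data.Nat.+ i)) (b ∸ a)

module Submission where

open import Defs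
open import Data.Nat using (ℕ; suc; _∸_)
open import Data.Nat.Combinatorics using (_C_)
open import Data.Integer using (ℤ; +_; -1ℤ; _^_)
open import Data.Rational using (ℚ; _/_; _+_)
open import Relation.Binary.PropositionalEquality using (_≡_)

open import Data.Nat using (zero; _≤_; _<_; s≤s; s≤s⁻¹)
open import Data.Nat.Combinatorics using (nCk+nC[k+1]≡[n+1]C[k+1]; nC1≡n; nCn≡1)
open import Data.Nat.Combinatorics.Specification using (k>n⇒nCk≡0)
open import Data.Rational using (0ℚ; toℚᵘ)
open import Function using (_∘_)
open import Relation.Binary.PropositionalEquality
  using (refl; sym; trans; cong; cong₂; module ≡-Reasoning)
import Data.Nat as N
import Data.Nat.Properties as NP
import Data.Integer as Z
import Data.Integer.Properties as ZP
import Data.Rational.Properties as QP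
import Data.Rational.Unnormalised as Qᵘ
import Data.Rational.Unnormalised.Properties as QᵘP
import Data.Nat.Tactic.RingSolver as NSolver
import Data.Integer.Tactic.RingSolver as ZSolver

-- * The alternating sum A = Σ_{n≤j≤2n} (-1)^{n+j} C(2n,j) (2n+1)/(j+1) is an
--   integer sum: by absorption C(2n,j)(2n+1) = C(2n+1,j+1)(j+1), so its terms
--   are (-1)^{n+j} C(2n+1,j+1).  Writing each C(2n+1,j+1) by Pascal's rule as
--   C(2n,j) + C(2n,j+1), the alternating sum telescopes to C(2n,n).
-- * The sum B = Σ_{j<n} C(n+j,j) C(2n-j-1,n-j) is, with paths a j = C(a+j,j),
--   the Chu–Vandermonde convolution Σ_{j≤n} paths n j · paths (n-1) (n-j)
--   without its last term paths n n = C(2n,n); Vandermonde evaluates the full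
--   convolution to paths (2n) n = C(3n,n), so B = C(3n,n) - C(2n,n).

module FiniteSums {A : Set} (o : A) (_⊕_ : A → A → A) where

  sum : (ℕ → A) → ℕ → A
  sum f zero    = o
  sum f (suc k) = sum f k ⊕ f k

  sum-cong : ∀ {f g : ℕ → A} k → (∀ i → i < k → f i ≡ g i) → sum f k ≡ sum g k
  sum-cong zero    f≡g = refl
  sum-cong (suc k) f≡g =
    cong₂ _⊕_ (sum-cong k (λ i i<k → f≡g i (NP.m<n⇒m<1+n i<k))) (f≡g k (NP.n<1+n k))

open FiniteSums 0 N._+_ using () renaming (sum to sumℕ; sum-cong to sumℕ-cong)
open FiniteSums (+ 0) Z._+_ using () renaming (sum to sumℤ; sum-cong to sumℤ-cong)
open FiniteSums 0ℚ _+_ using () renaming (sum to sumℚ; sum-cong to sumℚ-cong)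

sum-hom : ∀ {A B : Set} (o : A) (_⊕_ : A → A → A) (o′ : B) (_⊕′_ : B → B → B)
          (φ : A → B) → φ o ≡ o′ → (∀ x y → φ (x ⊕ y) ≡ φ x ⊕′ φ y) →
          ∀ f k → φ (FiniteSums.sum o _⊕_ f k) ≡ FiniteSums.sum o′ _⊕′_ (φ ∘ f) k
sum-hom o _⊕_ o′ _⊕′_ φ φ-zero φ-add f zero    = φ-zero
sum-hom o _⊕_ o′ _⊕′_ φ φ-zero φ-add f (suc k) =
  trans (φ-add _ (f k)) (cong (_⊕′ φ (f k)) (sum-hom o _⊕_ o′ _⊕′_ φ φ-zero φ-add f k))

sumBelow-sumℚ : ∀ (f : ℕ → ℚ) k → sumBelow f k ≡ sumℚ f k
sumBelow-sumℚ f zero    = refl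
sumBelow-sumℚ f (suc k) = cong (_+ f k) (sumBelow-sumℚ f k)

/1-homo-+ : ∀ a b → (a Z.+ b) / 1 ≡ a / 1 + b / 1
/1-homo-+ a b = QP.toℚᵘ-injective (begin
  toℚᵘ ((a Z.+ b) / 1)                 ≈⟨ QP.toℚᵘ-fromℚᵘ (Qᵘ.mkℚᵘ (a Z.+ b) 0) ⟩
  Qᵘ.mkℚᵘ (a Z.+ b) 0                     ≈⟨ Qᵘ.*≡* (numerators a b) ⟩
  Qᵘ.mkℚᵘ a 0 Qᵘ.+ Qᵘ.mkℚᵘ b 0            ≈⟨ QᵘP.+-cong (QP.toℚᵘ-fromℚᵘ (Qᵘ.mkℚᵘ a 0))
                                                         (QP.toℚᵘ-fromℚᵘ (Qᵘ.mkℚᵘ b 0)) ⟨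
  toℚᵘ (a / 1) Qᵘ.+ toℚᵘ (b / 1)    ≈⟨ QP.toℚᵘ-homo-+ (a / 1) (b / 1) ⟨
  toℚᵘ (a / 1 + b / 1)                 ∎)
  where
  open QᵘP.≃-Reasoning
  numerators : ∀ a b → (a Z.+ b) Z.* (+ 1 Z.* + 1) ≡ (a Z.* + 1 Z.+ b Z.* + 1) Z.* + 1
  numerators = ZSolver.solve-∀

cancel-denominator : ∀ y d → (y Z.* + suc d) / suc d ≡ y / 1
cancel-denominator y d =
  QP.fromℚᵘ-cong {Qᵘ.mkℚᵘ (y Z.* + suc d) d} {Qᵘ.mkℚᵘ y 0} (Qᵘ.*≡* (ZP.*-identityʳ (y Z.* + suc d)))

sumBelow-ℤ : ∀ {F : ℕ → ℚ} (h : ℕ → ℤ) k → (∀ i → i < k → F i ≡ h i / 1) →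
             sumBelow F k ≡ sumℤ h k / 1
sumBelow-ℤ {F} h k F≡h = begin
  sumBelow F k              ≡⟨ sumBelow-sumℚ F k ⟩
  sumℚ F k                  ≡⟨ sumℚ-cong k F≡h ⟩
  sumℚ (λ i → h i / 1) k    ≡⟨ sum-hom (+ 0) Z._+_ 0ℚ _+_ (λ z → z / 1) refl /1-homo-+ h k ⟨
  sumℤ h k / 1                      ∎
  where open ≡-Reasoning

sumℤ-ℕ : ∀ (h : ℕ → ℕ) k → sumℤ (λ i → + h i) k ≡ + sumℕ h k
sumℤ-ℕ h k = sym (sum-hom 0 N._+_ (+ 0) Z._+_ +_ refl ZP.pos-+ h k)

absorption : ∀ M j → (M C j) N.* suc M ≡ (suc M C suc j) N.* suc j
absorption zero    zero    = refl
absorption zero    (suc j) = refl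
absorption (suc M) zero    =
  trans (NP.*-identityˡ _) (sym (trans (NP.*-identityʳ _) (nC1≡n (suc (suc M)))))
absorption (suc M) (suc j) = begin
  c N.* suc (suc M)                                 ≡⟨ NP.*-suc c (suc M) ⟩
  c N.+ c N.* suc M                                 ≡⟨ cong (λ t → c N.+ t N.* suc M) (sym pascal-M) ⟩
  c N.+ (a N.+ b) N.* suc M                         ≡⟨ cong (c N.+_) (NP.*-distribʳ-+ (suc M) a b) ⟩
  c N.+ (a N.* suc M N.+ b N.* suc M)               ≡⟨ cong₂ (λ x y → c N.+ (x N.+ y))
                                                            (absorption M j) (absorption M (suc j)) ⟩
  c N.+ (c N.* suc j N.+ d N.* suc (suc j))         ≡⟨ collect c d j ⟩
  (c N.+ d) N.* suc (suc j)                         ≡⟨ cong (N._* suc (suc j)) pascal-suc-M ⟩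
  (suc (suc M) C suc (suc j)) N.* suc (suc j)       ∎
  where
  open ≡-Reasoning
  a = M C j
  b = M C suc j
  c = suc M C suc j
  d = suc M C suc (suc j)
  pascal-M : a N.+ b ≡ c
  pascal-M = nCk+nC[k+1]≡[n+1]C[k+1] M j
  pascal-suc-M : c N.+ d ≡ suc (suc M) C suc (suc j)
  pascal-suc-M = nCk+nC[k+1]≡[n+1]C[k+1] (suc M) (suc j)
  collect : ∀ c d j → c N.+ (c N.* suc j N.+ d N.* suc (suc j)) ≡ (c N.+ d) N.* suc (suc j)
  collect = NSolver.solve-∀

absorbed-term : ∀ s M j → (s Z.* + (M C j) Z.* + suc M) / suc j ≡ (s Z.* + (suc M C suc j)) / 1
absorbed-term s M j = trans (cong (λ t → t / suc j) numerator) (cancel-denominator (s Z.* + (suc M C suc j)) j)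
  where
  open ≡-Reasoning
  numerator : s Z.* + (M C j) Z.* + suc M ≡ s Z.* + (suc M C suc j) Z.* + suc j
  numerator = begin
    s Z.* + (M C j) Z.* + suc M             ≡⟨ ZP.*-assoc s _ _ ⟩
    s Z.* (+ (M C j) Z.* + suc M)           ≡⟨ cong (s Z.*_) (ZP.pos-* (M C j) (suc M)) ⟨
    s Z.* + ((M C j) N.* suc M)             ≡⟨ cong (λ t → s Z.* + t) (absorption M j) ⟩
    s Z.* + ((suc M C suc j) N.* suc j)     ≡⟨ cong (s Z.*_) (ZP.pos-* (suc M C suc j) (suc j)) ⟩
    s Z.* (+ (suc M C suc j) Z.* + suc j)   ≡⟨ ZP.*-assoc s _ _ ⟨
    s Z.* + (suc M C suc j) Z.* + suc j     ∎

alternating-telescope : ∀ (a : ℕ → ℤ) r →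
  sumℤ (λ i → -1ℤ ^ i Z.* (a i Z.+ a (suc i))) (suc r) ≡ a 0 Z.+ -1ℤ ^ r Z.* a (suc r)
alternating-telescope a zero    = base (a 0) (a 1)
  where
  base : ∀ x y → + 0 Z.+ + 1 Z.* (x Z.+ y) ≡ x Z.+ + 1 Z.* y
  base = ZSolver.solve-∀
alternating-telescope a (suc r) =
  trans (cong (Z._+ (-1ℤ ^ suc r Z.* (a (suc r) Z.+ a (suc (suc r))))) (alternating-telescope a r))
        (cancel (a 0) (-1ℤ ^ r) (a (suc r)) (a (suc (suc r))))
  where
  cancel : ∀ x s y z → x Z.+ s Z.* y Z.+ (-1ℤ Z.* s) Z.* (y Z.+ z) ≡ x Z.+ (-1ℤ Z.* s) Z.* z
  cancel = ZSolver.solve-∀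

alternating-row-sum : ∀ M m r →
  sumℤ (λ i → -1ℤ ^ i Z.* + (suc M C suc (m N.+ i))) (suc r)
    ≡ + (M C m) Z.+ -1ℤ ^ r Z.* + (M C suc (m N.+ r))
alternating-row-sum M m r = begin
  sumℤ (λ i → -1ℤ ^ i Z.* + (suc M C suc (m N.+ i))) (suc r)
    ≡⟨ sumℤ-cong (suc r) (λ i _ → cong (-1ℤ ^ i Z.*_) (pascal i)) ⟩
  sumℤ (λ i → -1ℤ ^ i Z.* (a i Z.+ a (suc i))) (suc r)
    ≡⟨ alternating-telescope a r ⟩
  a 0 Z.+ -1ℤ ^ r Z.* a (suc r)
    ≡⟨ cong₂ (λ x y → + (M C x) Z.+ -1ℤ ^ r Z.* + (M C y)) (NP.+-identityʳ m) (NP.+-suc m r) ⟩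
  + (M C m) Z.+ -1ℤ ^ r Z.* + (M C suc (m N.+ r))
    ∎
  where
  open ≡-Reasoning
  a : ℕ → ℤ
  a i = + (M C (m N.+ i))
  pascal : ∀ i → + (suc M C suc (m N.+ i)) ≡ a i Z.+ a (suc i)
  pascal i = begin
    + (suc M C suc (m N.+ i))                      ≡⟨ cong +_ (nCk+nC[k+1]≡[n+1]C[k+1] M (m N.+ i)) ⟨
    + (M C (m N.+ i) N.+ M C suc (m N.+ i))        ≡⟨ ZP.pos-+ (M C (m N.+ i)) (M C suc (m N.+ i)) ⟩
    a i Z.+ + (M C suc (m N.+ i))                  ≡⟨ cong (λ t → a i Z.+ + (M C t)) (NP.+-suc m i) ⟨
    a i Z.+ a (suc i)                              ∎

-- (-1)^(n+n) = 1, so the sign (-1)^(n+(n+i)) only depends on i.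
sign-shift : ∀ n i → -1ℤ ^ (n N.+ (n N.+ i)) ≡ -1ℤ ^ i
sign-shift n i = begin
  -1ℤ ^ (n N.+ (n N.+ i))         ≡⟨ cong (-1ℤ ^_) (NP.+-assoc n n i) ⟨
  -1ℤ ^ (n N.+ n N.+ i)           ≡⟨ ZP.^-distribˡ-+-* -1ℤ (n N.+ n) i ⟩
  -1ℤ ^ (n N.+ n) Z.* -1ℤ ^ i     ≡⟨ cong (Z._* -1ℤ ^ i) (even-power n) ⟩
  + 1 Z.* -1ℤ ^ i                 ≡⟨ ZP.*-identityˡ (-1ℤ ^ i) ⟩
  -1ℤ ^ i                         ∎
  where
  open ≡-Reasoning
  even-power : ∀ n → -1ℤ ^ (n N.+ n) ≡ + 1
  even-power zero    = refl
  even-power (suc n) = trans (cong (λ t → -1ℤ Z.* -1ℤ ^ t) (NP.+-suc n n))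
                             (cong (λ t → -1ℤ Z.* (-1ℤ Z.* t)) (even-power n))

-- 2·x = x + x, definitionally up to a trailing + 0.
double : ∀ x → 2 N.* x ≡ x N.+ x
double x = cong (x N.+_) (NP.+-identityʳ x)

alternating-sum : ∀ n →
  sumFromTo n (suc (2 N.* n))
    (λ j → ((-1ℤ ^ (n N.+ j)) Z.* (+ ((2 N.* n) C j)) Z.* (+ (suc (2 N.* n)))) / suc j)
  ≡ (+ ((2 N.* n) C n)) / 1
alternating-sum n = begin
  sumBelow (λ i → term (n N.+ i)) (suc M ∸ n)
    ≡⟨ cong (sumBelow _) length ⟩
  sumBelow (λ i → term (n N.+ i)) (suc n)
    ≡⟨ sumBelow-ℤ _ (suc n) (λ i _ → integral-term i) ⟩
  sumℤ (λ i → -1ℤ ^ i Z.* + (suc M C suc (n N.+ i))) (suc n) / 1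
    ≡⟨ cong (λ t → t / 1) (alternating-row-sum M n n) ⟩
  (+ (M C n) Z.+ -1ℤ ^ n Z.* + (M C suc (n N.+ n))) / 1
    ≡⟨ cong (λ c → (+ (M C n) Z.+ -1ℤ ^ n Z.* + c) / 1) (k>n⇒nCk≡0 beyond-row) ⟩
  (+ (M C n) Z.+ -1ℤ ^ n Z.* + 0) / 1
    ≡⟨ cong (λ t → t / 1) (drop-zero (+ (M C n)) (-1ℤ ^ n)) ⟩
  + (M C n) / 1
    ∎
  where
  open ≡-Reasoning
  M = 2 N.* n
  term : ℕ → ℚ
  term j = ((-1ℤ ^ (n N.+ j)) Z.* (+ (M C j)) Z.* (+ suc M)) / suc j
  length : suc M ∸ n ≡ suc n
  length = trans (cong (λ t → suc t ∸ n) (double n))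
                 (trans (cong (_∸ n) (sym (NP.+-suc n n))) (NP.m+n∸m≡n n (suc n)))
  integral-term : ∀ i → term (n N.+ i) ≡ (-1ℤ ^ i Z.* + (suc M C suc (n N.+ i))) / 1
  integral-term i = trans (cong (λ s → (s Z.* + (M C (n N.+ i)) Z.* + suc M) / suc (n N.+ i))
                                (sign-shift n i))
                          (absorbed-term (-1ℤ ^ i) M (n N.+ i))
  beyond-row : suc (n N.+ n) N.> M
  beyond-row = s≤s (NP.≤-reflexive (double n))
  drop-zero : ∀ x s → x Z.+ s Z.* + 0 ≡ x
  drop-zero = ZSolver.solve-∀

-- paths a j = C(a+j, j), the number of lattice paths with a steps east and j north.
paths : ℕ → ℕ → ℕ
paths a j = (a N.+ j) C j

-- Pascal's rule: a path ending at (b+1, m+1) arrives from (b, m+1) or from (b+1, m).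
paths-pascal : ∀ b m → paths (suc b) (suc m) ≡ paths b (suc m) N.+ paths (suc b) m
paths-pascal b m = begin
  (suc b N.+ suc m) C suc m                   ≡⟨ nCk+nC[k+1]≡[n+1]C[k+1] (b N.+ suc m) m ⟨
  (b N.+ suc m) C m N.+ paths b (suc m)       ≡⟨ NP.+-comm _ (paths b (suc m)) ⟩
  paths b (suc m) N.+ (b N.+ suc m) C m       ≡⟨ cong (λ t → paths b (suc m) N.+ t C m) (NP.+-suc b m) ⟩
  paths b (suc m) N.+ paths (suc b) m         ∎
  where open ≡-Reasoning

hockey-stick : ∀ a k → sumℕ (paths a) (suc k) ≡ paths (suc a) k
hockey-stick a zero    = refl
hockey-stick a (suc k) = begin
  sumℕ (paths a) (suc k) N.+ paths a (suc k)   ≡⟨ cong (N._+ paths a (suc k)) (hockey-stick a k) ⟩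
  paths (suc a) k N.+ paths a (suc k)          ≡⟨ NP.+-comm (paths (suc a) k) _ ⟩
  paths a (suc k) N.+ paths (suc a) k          ≡⟨ paths-pascal a k ⟨
  paths (suc a) (suc k)                        ∎
  where open ≡-Reasoning

convolution : ℕ → ℕ → ℕ → ℕ
convolution a b k = sumℕ (λ j → paths a j N.* paths b (k ∸ j)) (suc k)

sumℕ-+ : ∀ (u v : ℕ → ℕ) k → sumℕ (λ j → u j N.+ v j) k ≡ sumℕ u k N.+ sumℕ v k
sumℕ-+ u v zero    = refl
sumℕ-+ u v (suc k) =
  trans (cong (N._+ (u k N.+ v k)) (sumℕ-+ u v k)) (interchange (sumℕ u k) (sumℕ v k) (u k) (v k))
  where
  interchange : ∀ a b c d → (a N.+ b) N.+ (c N.+ d) ≡ (a N.+ c) N.+ (b N.+ d)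
  interchange = NSolver.solve-∀

-- Pascal's rule applied to the second factor splits a convolution in two.
convolution-pascal : ∀ a b k →
  convolution a (suc b) (suc k) ≡ convolution a b (suc k) N.+ convolution a (suc b) k
convolution-pascal a b k = begin
  sumℕ (λ j → paths a j N.* paths (suc b) (suc k ∸ j)) (suc k) N.+ last (suc b)
    ≡⟨ cong₂ N._+_ (sumℕ-cong (suc k) split-term) (cong (λ t → paths a (suc k) N.* t) last-factor) ⟩
  sumℕ (λ j → u j N.+ v j) (suc k) N.+ last b
    ≡⟨ cong (N._+ last b) (sumℕ-+ u v (suc k)) ⟩
  (sumℕ u (suc k) N.+ sumℕ v (suc k)) N.+ last b
    ≡⟨ swap (sumℕ u (suc k)) (sumℕ v (suc k)) (last b) ⟩
  (sumℕ u (suc k) N.+ last b) N.+ sumℕ v (suc k)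
    ∎
  where
  open ≡-Reasoning
  u v : ℕ → ℕ
  u j = paths a j N.* paths b (suc k ∸ j)
  v j = paths a j N.* paths (suc b) (k ∸ j)
  last : ℕ → ℕ
  last c = paths a (suc k) N.* paths c (k ∸ k)
  -- both last terms are paths a (suc k), since paths c 0 = 1
  last-factor : paths (suc b) (k ∸ k) ≡ paths b (k ∸ k)
  last-factor = trans (cong (paths (suc b)) (NP.n∸n≡0 k)) (sym (cong (paths b) (NP.n∸n≡0 k)))
  split-term : ∀ j → j < suc k → paths a j N.* paths (suc b) (suc k ∸ j) ≡ u j N.+ v j
  split-term j j<k+1 = begin
    paths a j N.* paths (suc b) (suc k ∸ j)                   ≡⟨ cong (λ t → paths a j N.* paths (suc b) t) step ⟩
    paths a j N.* paths (suc b) (suc (k ∸ j))                 ≡⟨ cong (paths a j N.*_) (paths-pascal b (k ∸ j)) ⟩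
    paths a j N.* (paths b (suc (k ∸ j)) N.+ paths (suc b) (k ∸ j))
                                                              ≡⟨ NP.*-distribˡ-+ (paths a j) _ _ ⟩
    paths a j N.* paths b (suc (k ∸ j)) N.+ v j               ≡⟨ cong (λ t → paths a j N.* paths b t N.+ v j) step ⟨
    u j N.+ v j                                               ∎
    where
    step : suc k ∸ j ≡ suc (k ∸ j)
    step = NP.+-∸-assoc 1 (s≤s⁻¹ j<k+1)
  swap : ∀ x y z → (x N.+ y) N.+ z ≡ (x N.+ z) N.+ y
  swap = NSolver.solve-∀

vandermonde : ∀ a b k → convolution a b k ≡ paths (suc (a N.+ b)) k
vandermonde a zero k = begin
  convolution a 0 k                        ≡⟨ sumℕ-cong (suc k) (λ j _ → trivial-factor j) ⟩
  sumℕ (paths a) (suc k)                   ≡⟨ hockey-stick a k ⟩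
  paths (suc a) k                          ≡⟨ cong (λ t → paths (suc t) k) (NP.+-identityʳ a) ⟨
  paths (suc (a N.+ 0)) k                  ∎
  where
  open ≡-Reasoning
  trivial-factor : ∀ j → paths a j N.* paths 0 (k ∸ j) ≡ paths a j
  trivial-factor j = trans (cong (paths a j N.*_) (nCn≡1 (k ∸ j))) (NP.*-identityʳ (paths a j))
vandermonde a (suc b) zero    = refl
vandermonde a (suc b) (suc k) = begin
  convolution a (suc b) (suc k)                        ≡⟨ convolution-pascal a b k ⟩
  convolution a b (suc k) N.+ convolution a (suc b) k  ≡⟨ cong₂ N._+_ (vandermonde a b (suc k))
                                                                   (vandermonde a (suc b) k) ⟩
  paths (suc s) (suc k) N.+ paths (suc (a N.+ suc b)) k ≡⟨ cong (λ t → paths (suc s) (suc k) N.+ paths (suc t) k)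
                                                               (NP.+-suc a b) ⟩
  paths (suc s) (suc k) N.+ paths (suc (suc s)) k      ≡⟨ paths-pascal (suc s) k ⟨
  paths (suc (suc s)) (suc k)                          ≡⟨ cong (λ t → paths (suc t) (suc k)) (NP.+-suc a b) ⟨
  paths (suc (a N.+ suc b)) (suc k)                    ∎
  where
  open ≡-Reasoning
  s = a N.+ b

second-summand : ℕ → ℕ → ℕ
second-summand n j = ((n N.+ j) C j) N.* (((2 N.* n ∸ j) ∸ 1) C (n ∸ j))

second-top : ∀ m j → j ≤ suc m → (2 N.* suc m ∸ j) ∸ 1 ≡ m N.+ (suc m ∸ j)
second-top m j j≤n = cong (_∸ 1) (trans (cong (_∸ j) (double (suc m))) (NP.+-∸-assoc (suc m) j≤n))

-- C(3n, n) = C(2n, n) + Σ_{j<n} C(n+j, j) C(2n-j-1, n-j): the Vandermonde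
-- convolution for a = n, b = n-1, k = n, with its last term C(2n, n) split off.
triple-binomial : ∀ n → (3 N.* n) C n ≡ (2 N.* n) C n N.+ sumℕ (second-summand n) n
triple-binomial zero    = refl
triple-binomial (suc m) = begin
  (3 N.* n) C n                               ≡⟨ cong (_C n) (three m) ⟩
  paths (suc (n N.+ m)) n                     ≡⟨ vandermonde n m n ⟨
  sumℕ vterm n N.+ paths n n N.* paths m (n ∸ n)
                                              ≡⟨ cong₂ N._+_ (sumℕ-cong n second-term) last-term ⟩
  sumℕ (second-summand n) n N.+ (2 N.* n) C n ≡⟨ NP.+-comm _ ((2 N.* n) C n) ⟩
  (2 N.* n) C n N.+ sumℕ (second-summand n) n ∎
  where
  open ≡-Reasoning
  n = suc m
  vterm : ℕ → ℕ
  vterm j = paths n j N.* paths m (n ∸ j)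
  three : ∀ m → 3 N.* suc m ≡ suc (suc m N.+ m) N.+ suc m
  three = NSolver.solve-∀
  second-term : ∀ j → j < n → vterm j ≡ second-summand n j
  second-term j j<n = cong (λ t → paths n j N.* (t C (n ∸ j))) (sym (second-top m j (NP.<⇒≤ j<n)))
  last-term : paths n n N.* paths m (n ∸ n) ≡ (2 N.* n) C n
  last-term = begin
    paths n n N.* paths m (n ∸ n)   ≡⟨ cong (λ t → paths n n N.* paths m t) (NP.n∸n≡0 n) ⟩
    paths n n N.* 1                 ≡⟨ NP.*-identityʳ (paths n n) ⟩
    (n N.+ n) C n                   ≡⟨ cong (_C n) (double n) ⟨
    (2 N.* n) C n                   ∎

mainTheorem17 : (n : ℕ) →
    (+ ((3 Data.Nat.* n) C n)) / 1
      ≡ sumFromTo n (suc (2 Data.Nat.* n))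
          (λ j → ((-1ℤ ^ (n Data.Nat.+ j)) Data.Integer.* (+ ((2 Data.Nat.* n) C j))
                   Data.Integer.* (+ (suc (2 Data.Nat.* n)))) / suc j)
        + sumFromTo 0 n
          (λ j → (+ (((n Data.Nat.+ j) C j) Data.Nat.* (((2 Data.Nat.* n ∸ j) ∸ 1) C (n ∸ j)))) / 1)
mainTheorem17 n = begin
  + ((3 N.* n) C n) / 1                        ≡⟨ cong (λ t → + t / 1) (triple-binomial n) ⟩
  + (C₂ N.+ S) / 1                             ≡⟨ cong (λ t → t / 1) (ZP.pos-+ C₂ S) ⟩
  (+ C₂ Z.+ + S) / 1                           ≡⟨ /1-homo-+ (+ C₂) (+ S) ⟩
  + C₂ / 1 + + S / 1                           ≡⟨ cong₂ _+_ (alternating-sum n) second-sum ⟨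
  _                                            ∎
  where
  open ≡-Reasoning
  C₂ = (2 N.* n) C n
  S = sumℕ (second-summand n) n
  second-sum : sumFromTo 0 n (λ j → + second-summand n j / 1) ≡ + S / 1
  second-sum = trans (sumBelow-ℤ _ n (λ _ _ → refl)) (cong (λ t → t / 1) (sumℤ-ℕ (second-summand n) n))
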